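{- If $n,k\in\mathbb{N}$ satisfy $0\le k\le\lfloor (n+2)/2\rfloor$, then there are poset isomorphisms \[ (\mathcal{A}_k(J([n]\times[2])),\le_k)\cong(\mathcal{A}_k(\mathcal{C}(n+2,2)),\le_k)\cong\mathcal{C}(n+2,2k). \]
   Context: $\mathbb{N}$ denotes the nonnegative integers, $[n]=\{1,\dots,n\}$ with its natural order, and $J(Q)$ is the poset of order ideals of a poset $Q$ ordered by inclusion. For $k\le n$, $\mathcal{C}(n,k)$ is the set of $k$-subsets of $[n]$, each written as an increasing sequence $(x_1<\dots<x_k)$, ordered by $\mathbf{x}\le\mathbf{y}$ iff $x_i\le y_i$ for all $i$. For a finite poset $P$, $\mathcal{A}_k(P)$ is the set of antichains of $P$ of cardinality $k$; for $A,B\in\mathcal{A}_k(P)$ write $A\prec_k B$ if $A\setminus B=\{a\}$ and $B\setminus A=\{b\}$ are singletons with $a<_P b$, and $\le_k$ is the reflexive transitive closure of $\prec_k$. -}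

module Defs where

open import Data.Nat using (ℕ; _≤_; _<_)
open import Data.Fin using (Fin)
import Data.Fin as F
open import Data.Bool using (Bool; true)
open import Data.Vec using (Vec; lookup)
open import Data.Product using (Σ; ∃; _×_; _,_; proj₁)
open import Data.Sum using (_⊎_)
open import Relation.Nullary using (¬_)
open import Relation.Binary.PropositionalEquality using (_≡_)
open import Relation.Binary.Construct.Closure.ReflexiveTransitive using (Star)

-- A carrier with an equality (setoid-style, so that "sets" may be
-- represented non-canonically) and an order relation.
record OrdStr : Set₁ where
  field
    Carrier : Set
    _≈ₚ_    : Carrier → Carrier → Set
    _≤ₚ_    : Carrier → Carrier → Set

_<ₚ_ : {P : OrdStr} → OrdStr.Carrier P → OrdStr.Carrier P → Set
_<ₚ_ {P} a b = (a ≤ₚ b) × ¬ (a ≈ₚ b)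
  where open OrdStr P

record PosetIso (P Q : OrdStr) : Set where
  module P = OrdStr P
  module Q = OrdStr Q
  field
    to        : P.Carrier → Q.Carrier
    from      : Q.Carrier → P.Carrier
    to-cong   : ∀ {x y} → x P.≈ₚ y → to x Q.≈ₚ to y
    from-cong : ∀ {x y} → x Q.≈ₚ y → from x P.≈ₚ from y
    from-to   : ∀ x → from (to x) P.≈ₚ x
    to-from   : ∀ y → to (from y) Q.≈ₚ y
    to-mono   : ∀ {x y} → x P.≤ₚ y → to x Q.≤ₚ to y
    to-refl   : ∀ {x y} → to x Q.≤ₚ to y → x P.≤ₚ y

-- C(n,k): k-subsets of [n] = {1..n} as increasing sequences x₁<…<xₖ,
-- ordered componentwise.

IsCombo : (n k : ℕ) → Vec ℕ k → Set
IsCombo n k v = (∀ i → (1 ≤ lookup v i) × (lookup v i ≤ n))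
              × (∀ (i j : Fin k) → i F.< j → lookup v i < lookup v j)

Combo : ℕ → ℕ → Set
Combo n k = Σ (Vec ℕ k) (IsCombo n k)

CPoset : ℕ → ℕ → OrdStr
CPoset n k = record
  { Carrier = Combo n k
  ; _≈ₚ_ = λ x y → proj₁ x ≡ proj₁ y
  ; _≤ₚ_ = λ x y → ∀ i → lookup (proj₁ x) i ≤ lookup (proj₁ y) i
  }

IsIdeal : {Q : Set} → (Q → Q → Set) → (Q → Bool) → Set
IsIdeal {Q} _≤Q_ S = ∀ (p q : Q) → p ≤Q q → S q ≡ true → S p ≡ true

JPoset : (Q : Set) → (Q → Q → Set) → OrdStr
JPoset Q _≤Q_ = record
  { Carrier = Σ (Q → Bool) (IsIdeal _≤Q_)
  ; _≈ₚ_ = λ S T → ∀ p → proj₁ S p ≡ proj₁ T p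
  ; _≤ₚ_ = λ S T → ∀ p → proj₁ S p ≡ true → proj₁ T p ≡ true
  }

-- [n] × [2] with the product order ([n] = Fin n with its natural order)
_≤[n×2]_ : {n : ℕ} → Fin n × Fin 2 → Fin n × Fin 2 → Set
(i , j) ≤[n×2] (i' , j') = (i F.≤ i') × (j F.≤ j')

J[n×2] : ℕ → OrdStr
J[n×2] n = JPoset (Fin n × Fin 2) _≤[n×2]_

-- An antichain is listed by k pairwise distinct, pairwise incomparable
-- elements; two listings are equal iff they have the same elements.

module _ (P : OrdStr) where
  open OrdStr P

  IsAntichain : (k : ℕ) → Vec Carrier k → Set
  IsAntichain k v = ∀ (i j : Fin k) → ¬ (i ≡ j) →
                    ¬ (lookup v i ≈ₚ lookup v j) × ¬ (lookup v i ≤ₚ lookup v j)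

  Antichain : ℕ → Set
  Antichain k = Σ (Vec Carrier k) (IsAntichain k)

  _∈A_ : {k : ℕ} → Carrier → Antichain k → Set
  _∈A_ {k} x A = ∃ λ (i : Fin k) → x ≈ₚ lookup (proj₁ A) i

  _≈A_ : {k : ℕ} → Antichain k → Antichain k → Set
  A ≈A B = ∀ x → (x ∈A A → x ∈A B) × (x ∈A B → x ∈A A)

  _≺A_ : {k : ℕ} → Antichain k → Antichain k → Set
  A ≺A B = Σ Carrier λ a → Σ Carrier λ b →
             (a ∈A A) × ¬ (a ∈A B) × (b ∈A B) × ¬ (b ∈A A)
           × (∀ x → x ∈A A → ¬ (x ∈A B) → x ≈ₚ a)
           × (∀ x → x ∈A B → ¬ (x ∈A A) → x ≈ₚ b)
           × _<ₚ_ {P} a b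

  _≤A_ : {k : ℕ} → Antichain k → Antichain k → Set
  _≤A_ = Star (λ A B → (A ≈A B) ⊎ (A ≺A B))

𝒜 : ℕ → OrdStr → OrdStr
𝒜 k P = record
  { Carrier = Antichain P k
  ; _≈ₚ_ = _≈A_ P
  ; _≤ₚ_ = _≤A_ P
  }

-- An order ideal of [n] × [2] is given by its two row lengths r₁ ≤ r₀ ≤ n, i.e. by the
-- 2-subset {r₁ + 1 < r₀ + 2} of [n + 2]; this poset isomorphism J([n] × [2]) ≅ C(n + 2, 2)
-- carries k-antichains and ≤ₖ along with it.
-- Two elements (a, b), (c, d) of C(m, 2) are incomparable exactly when one of the intervals
-- [a, b], [c, d] lies strictly inside the other, so a k-antichain is a nest of intervals
-- a₁ < … < aₖ < bₖ < … < b₁, i.e. an element of C(m, 2k).  A cover A ≺ₖ B replaces one interval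
-- by a componentwise larger one, which raises the sorted left ends and the sorted right ends
-- pointwise.  Conversely, a componentwise increase in C(m, 2k) splits into increments of one
-- coordinate by 1, and each of them moves one endpoint of one interval, which is a cover.
module Submission where

open import Defs
open import Data.Nat
  using (ℕ; zero; suc; _+_; _*_; _∸_; _⊓_; _≤_; _<_; _≤′_; ≤′-refl; ≤′-step; z≤n; s≤s; _<ᵇ_; _<?_; _≟_)
open import Data.Nat.DivMod using (_/_)
open import Data.Nat.Properties
  using ( ≤-refl; ≤-trans; ≤-antisym; ≤-total; ≤-pred; ≤-<-trans; <-≤-trans; <-trans; <-irrefl
        ; ≮⇒≥; ≰⇒>; <⇒≤; <⇒≢; ≤∧≢⇒<; ≤′⇒≤; ≤⇒≤′; n≤1+n; n<1+n; suc-injective; +-comm; +-identityʳ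
        ; ∸-monoˡ-≤; m+n∸n≡m; m+n∸m≡n; m+[n∸m]≡n; m≤m+n; m≤n⇒m⊓n≡m; <ᵇ⇒<; <⇒<ᵇ)
open import Data.Bool using (Bool; true; false; T)
open import Data.Bool.Properties using (T-≡)
open import Data.Unit using (tt)
open import Data.Empty using (⊥-elim)
open import Data.Fin using (Fin; toℕ) renaming (zero to fz; suc to fs)
import Data.Fin as F
import Data.Fin.Properties as F
open import Data.Vec using (Vec; []; _∷_; lookup; toList; fromList; cast)
import Data.Vec as Vec
open import Data.Vec.Properties
  using (lookup-map; toList-injective; toList-cast; toList∘fromList; cast-is-id; length-toList)
open import Data.List using (List; []; _∷_; length; map; _++_; reverse; _ʳ++_; zip; take; drop; filter)
open import Data.List.Properties
  using ( ʳ++-defn; ++-assoc; unfold-reverse; reverse-involutive; take++drop≡id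
        ; length-map; length-++; length-reverse; length-take; length-drop)
open import Data.List.Relation.Unary.All as All using (All; []; _∷_)
open import Data.List.Relation.Unary.Any using (here; there)
import Data.List.Relation.Unary.Any.Properties as Any
open import Data.List.Relation.Unary.AllPairs as AllPairs using (AllPairs; []; _∷_)
import Data.List.Relation.Unary.AllPairs.Properties as AllPairs
open import Data.List.Relation.Unary.Unique.Propositional using (Unique)
open import Data.List.Relation.Binary.Pointwise as Pointwise using (Pointwise; []; _∷_)
open import Data.List.Membership.Propositional using (_∈_; _∉_)
open import Data.List.Membership.Propositional.Properties using (∈-filter⁺; ∈-filter⁻)
open import Data.List.Relation.Binary.Subset.Propositional using (_⊆_)
import Data.List.Relation.Binary.Subset.Propositional.Properties as Subset
open import Data.Product using (∃; ∃₂; _×_; _,_; proj₁; proj₂)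
open import Data.Product.Properties using (≡-dec)
open import Data.Sum using (_⊎_; inj₁; inj₂)
open import Function using (_∘_; flip)
open import Function.Bundles using (Equivalence)
open import Relation.Nullary using (¬_; Dec; yes; no; ¬?)
open import Relation.Binary.Definitions using (Symmetric; DecidableEquality)
open import Relation.Binary.PropositionalEquality
  using (_≡_; _≢_; refl; sym; trans; cong; cong₂; subst; subst₂; module ≡-Reasoning)
open import Relation.Binary.Construct.Closure.ReflexiveTransitive using (Star; ε; _◅_; _◅◅_; gmap)

open ≡-Reasoning

-- Antichains of isomorphic posets

record IsOrderSetoid (P : OrdStr) : Set where
  open OrdStr P
  field
    ≈-refl    : ∀ {x} → x ≈ₚ x
    ≈-sym     : ∀ {x y} → x ≈ₚ y → y ≈ₚ x
    ≈-trans   : ∀ {x y z} → x ≈ₚ y → y ≈ₚ z → x ≈ₚ z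
    ≤-respˡ-≈ : ∀ {x y z} → x ≈ₚ y → y ≤ₚ z → x ≤ₚ z
    ≤-respʳ-≈ : ∀ {x y z} → x ≤ₚ y → y ≈ₚ z → x ≤ₚ z

PosetIso-sym : {P Q : OrdStr} → IsOrderSetoid Q → PosetIso P Q → PosetIso Q P
PosetIso-sym Q I = record
  { to        = from
  ; from      = to
  ; to-cong   = from-cong
  ; from-cong = to-cong
  ; from-to   = to-from
  ; to-from   = from-to
  ; to-mono   = λ {y} {y′} y≤y′ →
      to-refl (≤-respˡ-≈ (to-from y) (≤-respʳ-≈ y≤y′ (≈-sym (to-from y′))))
  ; to-refl   = λ {y} {y′} fy≤fy′ →
      ≤-respˡ-≈ (≈-sym (to-from y)) (≤-respʳ-≈ (to-mono fy≤fy′) (to-from y′))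
  }
  where
  open PosetIso I using (to; from; to-cong; from-cong; from-to; to-from; to-mono; to-refl)
  open IsOrderSetoid Q

module AntichainImage {P Q : OrdStr} (isP : IsOrderSetoid P) (isQ : IsOrderSetoid Q)
                      (I : PosetIso P Q) (k : ℕ) where
  private
    module P = OrdStr P
    module Q = OrdStr Q
    module isP = IsOrderSetoid isP
    module isQ = IsOrderSetoid isQ
  open PosetIso I using (to; from; to-cong; from-cong; from-to; to-from; to-mono; to-refl)

  to-injective : ∀ {x y} → to x Q.≈ₚ to y → x P.≈ₚ y
  to-injective {x} {y} e = isP.≈-trans (isP.≈-sym (from-to x)) (isP.≈-trans (from-cong e) (from-to y))

  map𝒜 : Antichain P k → Antichain Q k
  map𝒜 (v , anti) = Vec.map to v , λ i j i≢j →
    image (lookup-map i to v) (lookup-map j to v) (anti i j i≢j)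
    where
    image : ∀ {a b c d} → a ≡ to c → b ≡ to d →
            ¬ (c P.≈ₚ d) × ¬ (c P.≤ₚ d) → ¬ (a Q.≈ₚ b) × ¬ (a Q.≤ₚ b)
    image refl refl (c≉d , c≰d) = (λ e → c≉d (to-injective e)) , (λ le → c≰d (to-refl le))

  ∈-map𝒜⁺ : ∀ {x} (A : Antichain P k) → _∈A_ P x A → _∈A_ Q (to x) (map𝒜 A)
  ∈-map𝒜⁺ (v , _) (i , e) = i , subst (_ Q.≈ₚ_) (sym (lookup-map i to v)) (to-cong e)

  ∈-map𝒜⁻ : ∀ {x} (A : Antichain P k) → _∈A_ Q (to x) (map𝒜 A) → _∈A_ P x A
  ∈-map𝒜⁻ (v , _) (i , e) = i , to-injective (subst (_ Q.≈ₚ_) (lookup-map i to v) e)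

  ∈-map𝒜⇒from-∈ : ∀ {y} (A : Antichain P k) → _∈A_ Q y (map𝒜 A) → _∈A_ P (from y) A
  ∈-map𝒜⇒from-∈ {y} A (i , e) = ∈-map𝒜⁻ A (i , isQ.≈-trans (to-from y) e)

  from-∈⇒∈-map𝒜 : ∀ {y} (A : Antichain P k) → _∈A_ P (from y) A → _∈A_ Q y (map𝒜 A)
  from-∈⇒∈-map𝒜 {y} A y∈A with ∈-map𝒜⁺ A y∈A
  ... | i , e = i , isQ.≈-trans (isQ.≈-sym (to-from y)) e

  map𝒜-cong : ∀ {A B} → _≈A_ P A B → _≈A_ Q (map𝒜 A) (map𝒜 B)
  map𝒜-cong {A} {B} A≈B y =
      (λ y∈A → from-∈⇒∈-map𝒜 B (proj₁ (A≈B (from y)) (∈-map𝒜⇒from-∈ A y∈A)))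
    , (λ y∈B → from-∈⇒∈-map𝒜 A (proj₂ (A≈B (from y)) (∈-map𝒜⇒from-∈ B y∈B)))

  map𝒜-≺ : ∀ {A B} → _≺A_ P A B → _≺A_ Q (map𝒜 A) (map𝒜 B)
  map𝒜-≺ {A} {B} (a , b , a∈A , a∉B , b∈B , b∉A , onlyA , onlyB , a≤b , a≉b) =
      to a , to b
    , ∈-map𝒜⁺ A a∈A , (λ m → a∉B (∈-map𝒜⁻ B m))
    , ∈-map𝒜⁺ B b∈B , (λ m → b∉A (∈-map𝒜⁻ A m))
    , only A B onlyA , only B A onlyB
    , to-mono a≤b , (λ e → a≉b (to-injective e))
    where
    only : ∀ C D {c} → (∀ x → _∈A_ P x C → ¬ _∈A_ P x D → x P.≈ₚ c) →
           ∀ y → _∈A_ Q y (map𝒜 C) → ¬ _∈A_ Q y (map𝒜 D) → y Q.≈ₚ to c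
    only C D onlyC y y∈C y∉D = isQ.≈-trans (isQ.≈-sym (to-from y))
      (to-cong (onlyC (from y) (∈-map𝒜⇒from-∈ C y∈C) (λ m → y∉D (from-∈⇒∈-map𝒜 D m))))

  map𝒜-mono : ∀ {A B} → _≤A_ P A B → _≤A_ Q (map𝒜 A) (map𝒜 B)
  map𝒜-mono ε = ε
  map𝒜-mono {A} (_◅_ {j = C} (inj₁ A≈C) C≤B) = inj₁ (map𝒜-cong {A} {C} A≈C) ◅ map𝒜-mono C≤B
  map𝒜-mono {A} (_◅_ {j = C} (inj₂ A≺C) C≤B) = inj₂ (map𝒜-≺ {A} {C} A≺C) ◅ map𝒜-mono C≤B

≈A-sym : ∀ {P : OrdStr} {k} {A B : Antichain P k} → _≈A_ P A B → _≈A_ P B A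
≈A-sym A≈B x = proj₂ (A≈B x) , proj₁ (A≈B x)

JPoset-isOrderSetoid : ∀ Q (_≤Q_ : Q → Q → Set) → IsOrderSetoid (JPoset Q _≤Q_)
JPoset-isOrderSetoid Q _≤Q_ = record
  { ≈-refl    = λ _ → refl
  ; ≈-sym     = λ S≈T p → sym (S≈T p)
  ; ≈-trans   = λ S≈T T≈U p → trans (S≈T p) (T≈U p)
  ; ≤-respˡ-≈ = λ S≈T T⊆U p Sp → T⊆U p (trans (sym (S≈T p)) Sp)
  ; ≤-respʳ-≈ = λ S⊆T T≈U p Sp → trans (sym (T≈U p)) (S⊆T p Sp)
  }

CPoset-isOrderSetoid : ∀ m k → IsOrderSetoid (CPoset m k)
CPoset-isOrderSetoid m k = record
  { ≈-refl    = refl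
  ; ≈-sym     = sym
  ; ≈-trans   = trans
  ; ≤-respˡ-≈ = λ x≡y y≤z i → subst (λ v → lookup v i ≤ _) (sym x≡y) (y≤z i)
  ; ≤-respʳ-≈ = λ x≤y y≡z i → subst (λ v → _ ≤ lookup v i) y≡z (x≤y i)
  }

PosetIso-𝒜 : {P Q : OrdStr} → IsOrderSetoid P → IsOrderSetoid Q →
             PosetIso P Q → (k : ℕ) → PosetIso (𝒜 k P) (𝒜 k Q)
PosetIso-𝒜 {P} isP isQ I k = record
  { to        = There.map𝒜
  ; from      = Back.map𝒜
  ; to-cong   = λ {A} {B} → There.map𝒜-cong {A} {B}
  ; from-cong = λ {A} {B} → Back.map𝒜-cong {A} {B}
  ; from-to   = back-there
  ; to-from   = λ B y → (λ m → Back.∈-map𝒜⁻ B (There.∈-map𝒜⇒from-∈ (Back.map𝒜 B) m))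
                      , (λ m → There.from-∈⇒∈-map𝒜 (Back.map𝒜 B) (Back.∈-map𝒜⁺ B m))
  ; to-mono   = λ {A} {B} → There.map𝒜-mono {A} {B}
  ; to-refl   = λ {A} {B} A≤B →
      inj₁ (≈A-sym {P} {A = Back.map𝒜 (There.map𝒜 A)} {A} (back-there A))
      ◅ (Back.map𝒜-mono {There.map𝒜 A} {There.map𝒜 B} A≤B ◅◅ (inj₁ (back-there B) ◅ ε))
  }
  where
  module There = AntichainImage isP isQ I k
  module Back  = AntichainImage isQ isP (PosetIso-sym isQ I) k

  back-there : ∀ A → _≈A_ P (Back.map𝒜 (There.map𝒜 A)) A
  back-there A x = (λ m → There.∈-map𝒜⁻ A (Back.∈-map𝒜⇒from-∈ (There.map𝒜 A) m))
                 , (λ m → Back.from-∈⇒∈-map𝒜 (There.map𝒜 A) (There.∈-map𝒜⁺ A m))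

-- Order ideals of [n] × [2]

DownClosed : ∀ {n} → (Fin n → Bool) → Set
DownClosed {n} S = ∀ (i j : Fin n) → i F.≤ j → S j ≡ true → S i ≡ true

prefix : ∀ {n} → ℕ → Fin n → Bool
prefix t i = toℕ i <ᵇ t

prefix⇒< : ∀ {n t} (i : Fin n) → prefix t i ≡ true → toℕ i < t
prefix⇒< {t = t} i e = <ᵇ⇒< (toℕ i) t (subst T (sym e) tt)

<⇒prefix : ∀ {n t} (i : Fin n) → toℕ i < t → prefix t i ≡ true
<⇒prefix i i<t = Equivalence.to T-≡ (<⇒<ᵇ i<t)

prefix-mono : ∀ {n t t′} → t ≤ t′ → (i : Fin n) → prefix t i ≡ true → prefix t′ i ≡ true
prefix-mono t≤t′ i e = <⇒prefix i (≤-trans (prefix⇒< i e) t≤t′)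

runLength : ∀ {n} → (Fin n → Bool) → ℕ
runLength {zero}  S = 0
runLength {suc n} S with S fz
... | true  = suc (runLength (λ i → S (fs i)))
... | false = 0

runLength≤n : ∀ {n} (S : Fin n → Bool) → runLength S ≤ n
runLength≤n {zero}  S = z≤n
runLength≤n {suc n} S with S fz
... | true  = s≤s (runLength≤n (λ i → S (fs i)))
... | false = z≤n

runLength-mono : ∀ {n} (S T : Fin n → Bool) → (∀ i → S i ≡ true → T i ≡ true) →
                 runLength S ≤ runLength T
runLength-mono {zero}  S T S⊆T = z≤n
runLength-mono {suc n} S T S⊆T with S fz in S0
... | false = z≤n
... | true with T fz in T0
...   | true  = s≤s (runLength-mono (λ i → S (fs i)) (λ i → T (fs i)) (λ i → S⊆T (fs i)))
...   | false with trans (sym (S⊆T fz S0)) T0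
...     | ()

runLength-cong : ∀ {n} (S T : Fin n → Bool) → (∀ i → S i ≡ T i) → runLength S ≡ runLength T
runLength-cong S T S≗T = ≤-antisym (runLength-mono S T (λ i → trans (sym (S≗T i))))
                                   (runLength-mono T S (λ i → trans (S≗T i)))

runLength-prefix : ∀ {n} t → t ≤ n → runLength {n} (prefix t) ≡ t
runLength-prefix {zero}  zero    _         = refl
runLength-prefix {suc n} zero    _         = refl
runLength-prefix {suc n} (suc t) (s≤s t≤n) = cong suc (runLength-prefix t t≤n)

DownClosed⇒prefix : ∀ {n} (S : Fin n → Bool) → DownClosed S → ∀ i → S i ≡ prefix (runLength S) i
DownClosed⇒prefix {suc n} S down i with S fz in S0
DownClosed⇒prefix {suc n} S down fz     | true = S0
DownClosed⇒prefix {suc n} S down (fs i) | true =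
  DownClosed⇒prefix (λ i → S (fs i)) (λ i j i≤j → down (fs i) (fs j) (s≤s i≤j)) i
DownClosed⇒prefix {suc n} S down i      | false with S i in Si
... | true  = trans (sym (down fz i z≤n Si)) S0
... | false = refl

m≤n⇒2+m≤n+2 : ∀ {m n} → m ≤ n → 2 + m ≤ n + 2
m≤n⇒2+m≤n+2 {m} {n} m≤n = subst (2 + m ≤_) (+-comm 2 n) (s≤s (s≤s m≤n))

m<n⇒m∸1≤n∸2 : ∀ {m n} → m < n → m ∸ 1 ≤ n ∸ 2
m<n⇒m∸1≤n∸2 {zero}                _               = z≤n
m<n⇒m∸1≤n∸2 {suc m} {suc (suc n)} (s≤s (s≤s m≤n)) = m≤n

module GridIdeals (n : ℕ) where

  Ideal : Set
  Ideal = OrdStr.Carrier (J[n×2] n)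

  row : Ideal → Fin 2 → Fin n → Bool
  row S j i = proj₁ S (i , j)

  row-DownClosed : (S : Ideal) (j : Fin 2) → DownClosed (row S j)
  row-DownClosed S j i i′ i≤i′ = proj₂ S (i , j) (i′ , j) (i≤i′ , ≤-refl)

  r₀ r₁ : Ideal → ℕ
  r₀ S = runLength (row S fz)
  r₁ S = runLength (row S (fs fz))

  r₁≤r₀ : ∀ S → r₁ S ≤ r₀ S
  r₁≤r₀ S = runLength-mono _ _ (λ i → proj₂ S (i , fz) (i , fs fz) (≤-refl , z≤n))

  toCombo : Ideal → Combo (n + 2) 2
  toCombo S = v , bounds , increasing
    where
    v : Vec ℕ 2
    v = suc (r₁ S) ∷ suc (suc (r₀ S)) ∷ []
    bounds : ∀ i → (1 ≤ lookup v i) × (lookup v i ≤ n + 2)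
    bounds fz      = s≤s z≤n , ≤-trans (n≤1+n _) (m≤n⇒2+m≤n+2 (runLength≤n (row S (fs fz))))
    bounds (fs fz) = s≤s z≤n , m≤n⇒2+m≤n+2 (runLength≤n (row S fz))
    increasing : ∀ (i j : Fin 2) → i F.< j → lookup v i < lookup v j
    increasing fz      (fs fz) _         = s≤s (s≤s (r₁≤r₀ S))
    increasing (fs fz) (fs fz) (s≤s ())

  rows : Vec ℕ 2 → Fin n × Fin 2 → Bool
  rows (x₁ ∷ x₂ ∷ []) (i , fz)    = prefix (x₂ ∸ 2) i
  rows (x₁ ∷ x₂ ∷ []) (i , fs fz) = prefix (x₁ ∸ 1) i

  fromCombo : Combo (n + 2) 2 → Ideal
  fromCombo (x₁ ∷ x₂ ∷ [] , _ , increasing) = rows (x₁ ∷ x₂ ∷ []) , isIdeal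
    where
    row₁⊆row₀ : x₁ ∸ 1 ≤ x₂ ∸ 2
    row₁⊆row₀ = m<n⇒m∸1≤n∸2 (increasing fz (fs fz) (s≤s z≤n))
    isIdeal : IsIdeal _≤[n×2]_ (rows (x₁ ∷ x₂ ∷ []))
    isIdeal (i , fz)    (i′ , fz)    (i≤i′ , _) q =
      <⇒prefix i (≤-<-trans i≤i′ (prefix⇒< {t = x₂ ∸ 2} i′ q))
    isIdeal (i , fz)    (i′ , fs fz) (i≤i′ , _) q =
      <⇒prefix i (≤-trans (s≤s i≤i′) (≤-trans (prefix⇒< i′ q) row₁⊆row₀))
    isIdeal (i , fs fz) (i′ , fs fz) (i≤i′ , _) q =
      <⇒prefix i (≤-<-trans i≤i′ (prefix⇒< {t = x₁ ∸ 1} i′ q))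
    isIdeal (i , fs fz) (i′ , fz)    (_ , ())   q

  row-prefix : ∀ S j i → row S j i ≡ prefix (runLength (row S j)) i
  row-prefix S j = DownClosed⇒prefix (row S j) (row-DownClosed S j)

  from-to : ∀ S p → proj₁ (fromCombo (toCombo S)) p ≡ proj₁ S p
  from-to S (i , fz)    = sym (row-prefix S fz i)
  from-to S (i , fs fz) = sym (row-prefix S (fs fz) i)

  to-from : ∀ x → proj₁ (toCombo (fromCombo x)) ≡ proj₁ x
  to-from (x₁ ∷ x₂ ∷ [] , bounds , increasing) = cong₂ (λ a b → a ∷ b ∷ []) e₁ e₂
    where
    1≤x₁  = proj₁ (bounds fz)
    x₁<x₂ = increasing fz (fs fz) (s≤s z≤n)
    x₂∸2≤n : x₂ ∸ 2 ≤ n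
    x₂∸2≤n = subst (x₂ ∸ 2 ≤_) (m+n∸n≡m n 2) (∸-monoˡ-≤ 2 (proj₂ (bounds (fs fz))))
    e₁ : 1 + runLength {n} (prefix (x₁ ∸ 1)) ≡ x₁
    e₁ = trans (cong (1 +_) (runLength-prefix (x₁ ∸ 1) (≤-trans (m<n⇒m∸1≤n∸2 x₁<x₂) x₂∸2≤n)))
               (m+[n∸m]≡n 1≤x₁)
    e₂ : 2 + runLength {n} (prefix (x₂ ∸ 2)) ≡ x₂
    e₂ = trans (cong (2 +_) (runLength-prefix (x₂ ∸ 2) x₂∸2≤n))
               (m+[n∸m]≡n (≤-trans (s≤s 1≤x₁) x₁<x₂))

  toCombo-mono : ∀ S T → (∀ p → proj₁ S p ≡ true → proj₁ T p ≡ true) →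
                 ∀ i → lookup (proj₁ (toCombo S)) i ≤ lookup (proj₁ (toCombo T)) i
  toCombo-mono S T S⊆T fz      = s≤s (runLength-mono _ _ (λ i → S⊆T (i , fs fz)))
  toCombo-mono S T S⊆T (fs fz) = s≤s (s≤s (runLength-mono _ _ (λ i → S⊆T (i , fz))))

  toCombo-reflects : ∀ S T → (∀ i → lookup (proj₁ (toCombo S)) i ≤ lookup (proj₁ (toCombo T)) i) →
                     ∀ p → proj₁ S p ≡ true → proj₁ T p ≡ true
  toCombo-reflects S T S≤T (i , j) Sp =
    trans (row-prefix T j i) (prefix-mono (r≤r j) i (trans (sym (row-prefix S j i)) Sp))
    where
    r≤r : ∀ j → runLength (row S j) ≤ runLength (row T j)
    r≤r fz      = ≤-pred (≤-pred (S≤T (fs fz)))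
    r≤r (fs fz) = ≤-pred (S≤T fz)

  fromCombo-cong : ∀ {x y} → proj₁ x ≡ proj₁ y → ∀ p → proj₁ (fromCombo x) p ≡ proj₁ (fromCombo y) p
  fromCombo-cong {x₁ ∷ x₂ ∷ [] , _} {.(x₁ ∷ x₂ ∷ []) , _} refl p = refl

J[n×2]≅C[n+2,2] : ∀ n → PosetIso (J[n×2] n) (CPoset (n + 2) 2)
J[n×2]≅C[n+2,2] n = record
  { to        = toCombo
  ; from      = fromCombo
  ; to-cong   = λ {S} {T} S≈T → cong₂ (λ b a → suc b ∷ suc (suc a) ∷ [])
                  (runLength-cong (row S (fs fz)) (row T (fs fz)) (λ i → S≈T (i , fs fz)))
                  (runLength-cong (row S fz) (row T fz) (λ i → S≈T (i , fz)))
  ; from-cong = λ {x} {y} → fromCombo-cong {x} {y}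
  ; from-to   = from-to
  ; to-from   = to-from
  ; to-mono   = λ {S} {T} → toCombo-mono S T
  ; to-refl   = λ {S} {T} → toCombo-reflects S T
  }
  where open GridIdeals n

-- Sorting lists with distinct keys

AllPairs-∈ : ∀ {A : Set} {R : A → A → Set} {xs} → Symmetric R → AllPairs R xs →
             ∀ {x y} → x ∈ xs → y ∈ xs → x ≢ y → R x y
AllPairs-∈ R-sym (Rx ∷ _)  (here refl) (here refl) x≢y = ⊥-elim (x≢y refl)
AllPairs-∈ R-sym (Rx ∷ _)  (here refl) (there y∈) _   = All.lookup Rx y∈
AllPairs-∈ R-sym (Rx ∷ _)  (there x∈)  (here refl) _  = R-sym (All.lookup Rx x∈)
AllPairs-∈ R-sym (_ ∷ Rxs) (there x∈)  (there y∈) x≢y = AllPairs-∈ R-sym Rxs x∈ y∈ x≢y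

AllPairs-∷ : ∀ {A : Set} {R : A → A → Set} {L r X} → Symmetric R → AllPairs R L →
             r ∈ L → X ⊆ L → All (_≢ r) X → AllPairs R X → AllPairs R (r ∷ X)
AllPairs-∷ R-sym RL r∈L X⊆L X≢r RX =
  All.tabulate (λ z∈X → AllPairs-∈ R-sym RL r∈L (X⊆L z∈X) (λ e → All.lookup X≢r z∈X (sym e))) ∷ RX

AllPairs-reverse : ∀ {A : Set} {R : A → A → Set} {xs} → AllPairs R xs → AllPairs (flip R) (reverse xs)
AllPairs-reverse {xs = []}     []          = []
AllPairs-reverse {xs = x ∷ xs} (Rx ∷ Rxs) = subst (AllPairs _) (sym (unfold-reverse x xs))
  (AllPairs.++⁺ (AllPairs-reverse Rxs) ([] ∷ [])
                (All.tabulate (λ m → All.lookup Rx (Any.reverse⁻ m) ∷ [])))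

module SortBy {A : Set} (κ : A → ℕ) where

  Sorted : List A → Set
  Sorted = AllPairs (λ x y → κ x < κ y)

  DistinctKeys : List A → Set
  DistinctKeys = AllPairs (λ x y → κ x ≢ κ y)

  insert : A → List A → List A
  insert x [] = x ∷ []
  insert x (y ∷ ys) with κ x <? κ y
  ... | yes _ = x ∷ y ∷ ys
  ... | no  _ = y ∷ insert x ys

  sort : List A → List A
  sort []       = []
  sort (x ∷ xs) = insert x (sort xs)

  length-insert : ∀ x ys → length (insert x ys) ≡ suc (length ys)
  length-insert x [] = refl
  length-insert x (y ∷ ys) with κ x <? κ y
  ... | yes _ = refl
  ... | no  _ = cong suc (length-insert x ys)

  length-sort : ∀ xs → length (sort xs) ≡ length xs
  length-sort []       = refl
  length-sort (x ∷ xs) = trans (length-insert x (sort xs)) (cong suc (length-sort xs))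

  ∈-insert⁻ : ∀ {z} x ys → z ∈ insert x ys → z ≡ x ⊎ z ∈ ys
  ∈-insert⁻ x [] (here e) = inj₁ e
  ∈-insert⁻ x (y ∷ ys) z∈ with κ x <? κ y
  ∈-insert⁻ x (y ∷ ys) (here e)  | yes _ = inj₁ e
  ∈-insert⁻ x (y ∷ ys) (there m) | yes _ = inj₂ m
  ∈-insert⁻ x (y ∷ ys) (here e)  | no  _ = inj₂ (here e)
  ∈-insert⁻ x (y ∷ ys) (there m) | no  _ with ∈-insert⁻ x ys m
  ... | inj₁ e = inj₁ e
  ... | inj₂ m′ = inj₂ (there m′)

  ∈-insert⁺ : ∀ {z} x ys → z ≡ x ⊎ z ∈ ys → z ∈ insert x ys
  ∈-insert⁺ x [] (inj₁ e) = here e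
  ∈-insert⁺ x (y ∷ ys) z∈ with κ x <? κ y
  ∈-insert⁺ x (y ∷ ys) (inj₁ e)         | yes _ = here e
  ∈-insert⁺ x (y ∷ ys) (inj₂ m)         | yes _ = there m
  ∈-insert⁺ x (y ∷ ys) (inj₁ e)         | no  _ = there (∈-insert⁺ x ys (inj₁ e))
  ∈-insert⁺ x (y ∷ ys) (inj₂ (here e))  | no  _ = here e
  ∈-insert⁺ x (y ∷ ys) (inj₂ (there m)) | no  _ = there (∈-insert⁺ x ys (inj₂ m))

  ∈-sort⁻ : ∀ {z} xs → z ∈ sort xs → z ∈ xs
  ∈-sort⁻ (x ∷ xs) m with ∈-insert⁻ x (sort xs) m
  ... | inj₁ e  = here e
  ... | inj₂ m′ = there (∈-sort⁻ xs m′)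

  ∈-sort⁺ : ∀ {z} xs → z ∈ xs → z ∈ sort xs
  ∈-sort⁺ (x ∷ xs) (here e)  = ∈-insert⁺ x (sort xs) (inj₁ e)
  ∈-sort⁺ (x ∷ xs) (there m) = ∈-insert⁺ x (sort xs) (inj₂ (∈-sort⁺ xs m))

  insert-sorted : ∀ x ys → Sorted ys → All (λ y → κ x ≢ κ y) ys → Sorted (insert x ys)
  insert-sorted x [] _ _ = [] ∷ []
  insert-sorted x (y ∷ ys) (y<ys ∷ ys↑) (x≢y ∷ x≢ys) with κ x <? κ y
  ... | yes x<y = (x<y ∷ All.map (<-trans x<y) y<ys) ∷ y<ys ∷ ys↑
  ... | no  x≮y = All.tabulate y<insert ∷ insert-sorted x ys ys↑ x≢ys
    where
    y<insert : ∀ {z} → z ∈ insert x ys → κ y < κ z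
    y<insert m with ∈-insert⁻ x ys m
    ... | inj₁ refl = ≤∧≢⇒< (≮⇒≥ x≮y) (λ e → x≢y (sym e))
    ... | inj₂ m′   = All.lookup y<ys m′

  sort-sorted : ∀ xs → DistinctKeys xs → Sorted (sort xs)
  sort-sorted []       _              = []
  sort-sorted (x ∷ xs) (x≢xs ∷ xs≢) =
    insert-sorted x (sort xs) (sort-sorted xs xs≢) (All.tabulate (λ m → All.lookup x≢xs (∈-sort⁻ xs m)))

  AllPairs-sort : ∀ {R : A → A → Set} → Symmetric R → ∀ {xs} → AllPairs R xs → AllPairs R (sort xs)
  AllPairs-sort          R-sym {[]}     []          = []
  AllPairs-sort {R = R} R-sym {x ∷ xs} (Rx ∷ Rxs) = insert⁺ (sort xs) (AllPairs-sort R-sym Rxs)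
    (All.tabulate (λ m → All.lookup Rx (∈-sort⁻ xs m)))
    where
    insert⁺ : ∀ ys → AllPairs R ys → All (R x) ys → AllPairs R (insert x ys)
    insert⁺ [] _ _ = [] ∷ []
    insert⁺ (y ∷ ys) (Ry ∷ Rys) (Rxy ∷ Rxys) with κ x <? κ y
    ... | yes _ = (Rxy ∷ Rxys) ∷ Ry ∷ Rys
    ... | no  _ = All.tabulate Ry-insert ∷ insert⁺ ys Rys Rxys
      where
      Ry-insert : ∀ {z} → z ∈ insert x ys → R y z
      Ry-insert m with ∈-insert⁻ x ys m
      ... | inj₁ refl = R-sym Rxy
      ... | inj₂ m′   = All.lookup Ry m′

  sorted-unique : ∀ {xs ys} → Sorted xs → Sorted ys → xs ⊆ ys → ys ⊆ xs → xs ≡ ys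
  sorted-unique {[]}     {[]}     _ _ _ _ = refl
  sorted-unique {[]}     {y ∷ ys} _ _ _ ys⊆ with ys⊆ (here refl)
  ... | ()
  sorted-unique {x ∷ xs} {[]}     _ _ xs⊆ _ with xs⊆ (here refl)
  ... | ()
  sorted-unique {x ∷ xs} {y ∷ ys} (x<xs ∷ xs↑) (y<ys ∷ ys↑) xs⊆ ys⊆ =
    cong₂ _∷_ x≡y (sorted-unique xs↑ ys↑ tail⊆ tail⊇)
    where
    x≡y : x ≡ y
    x≡y with xs⊆ (here refl) | ys⊆ (here refl)
    ... | here e  | _       = e
    ... | there _ | here e  = sym e
    ... | there m | there m′ = ⊥-elim (<-irrefl refl (<-trans (All.lookup y<ys m) (All.lookup x<xs m′)))
    tail⊆ : xs ⊆ ys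
    tail⊆ m with xs⊆ (there m)
    ... | here refl = ⊥-elim (<-irrefl (cong κ x≡y) (All.lookup x<xs m))
    ... | there m′  = m′
    tail⊇ : ys ⊆ xs
    tail⊇ m with ys⊆ (there m)
    ... | here refl = ⊥-elim (<-irrefl (cong κ (sym x≡y)) (All.lookup y<ys m))
    ... | there m′  = m′

  sorted-≡-sort : ∀ {xs ys} → Sorted xs → DistinctKeys ys → xs ⊆ ys → ys ⊆ xs → xs ≡ sort ys
  sorted-≡-sort {ys = ys} xs↑ ys≢ xs⊆ ys⊆ =
    sorted-unique xs↑ (sort-sorted ys ys≢) (λ m → ∈-sort⁺ ys (xs⊆ m)) (λ m → ys⊆ (∈-sort⁻ ys m))

  sort-Sorted : ∀ {xs} → Sorted xs → sort xs ≡ xs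
  sort-Sorted xs↑ = sym (sorted-≡-sort xs↑ (AllPairs.map <⇒≢ xs↑) (λ m → m) (λ m → m))

module SortNat = SortBy {ℕ} (λ x → x)
open SortNat using (insert)

∷-≤-insert : ∀ {x q} L → x ≤ q → All (x ≤_) L → SortNat.Sorted L → Pointwise _≤_ (x ∷ L) (insert q L)
∷-≤-insert []      x≤q _ _ = x≤q ∷ []
∷-≤-insert {q = q} (z ∷ L) x≤q (x≤z ∷ _) (z<L ∷ L↑) with q <? z
... | yes _ = x≤q ∷ Pointwise.refl ≤-refl
... | no q≮z = x≤z ∷ ∷-≤-insert L (≮⇒≥ q≮z) (All.map <⇒≤ z<L) L↑

insert-mono : ∀ {p p′} L → p ≤ p′ → SortNat.Sorted L → Pointwise _≤_ (insert p L) (insert p′ L)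
insert-mono []  p≤p′ _ = p≤p′ ∷ []
insert-mono {p} {p′} (y ∷ L) p≤p′ (y<L ∷ L↑) with p <? y | p′ <? y
... | yes _   | yes _    = p≤p′ ∷ Pointwise.refl ≤-refl
... | yes p<y | no p′≮y  = <⇒≤ p<y ∷ ∷-≤-insert L (≮⇒≥ p′≮y) (All.map <⇒≤ y<L) L↑
... | no p≮y  | yes p′<y = ⊥-elim (p≮y (≤-<-trans p≤p′ p′<y))
... | no _    | no _     = ≤-refl ∷ insert-mono L p≤p′ L↑

-- Nested intervals

ℕ² : Set
ℕ² = ℕ × ℕ

_≟²_ : DecidableEquality ℕ²
_≟²_ = ≡-dec _≟_ _≟_

_≢?_ : (p q : ℕ²) → Dec (p ≢ q)
p ≢? q = ¬? (p ≟² q)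

_≤²_ : ℕ² → ℕ² → Set
(a , b) ≤² (c , d) = a ≤ c × b ≤ d

Incomparable : ℕ² → ℕ² → Set
Incomparable p q = ¬ p ≤² q × ¬ q ≤² p

Encloses : ℕ² → ℕ² → Set
Encloses p q = proj₁ p < proj₁ q × proj₂ q < proj₂ p

Incomparable-sym : ∀ {p q} → Incomparable p q → Incomparable q p
Incomparable-sym (p≰q , q≰p) = q≰p , p≰q

Incomparable⇒proj₁≢ : ∀ {p q} → Incomparable p q → proj₁ p ≢ proj₁ q
Incomparable⇒proj₁≢ {a , b} {.a , d} (p≰q , q≰p) refl with ≤-total b d
... | inj₁ b≤d = p≰q (≤-refl , b≤d)
... | inj₂ d≤b = q≰p (≤-refl , d≤b)

Incomparable⇒proj₂≢ : ∀ {p q} → Incomparable p q → proj₂ p ≢ proj₂ q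
Incomparable⇒proj₂≢ {a , b} {c , .b} (p≰q , q≰p) refl with ≤-total a c
... | inj₁ a≤c = p≰q (a≤c , ≤-refl)
... | inj₂ c≤a = q≰p (c≤a , ≤-refl)

Incomparable⇒≢ : ∀ {p q} → Incomparable p q → p ≢ q
Incomparable⇒≢ p∥q refl = Incomparable⇒proj₁≢ p∥q refl

Encloses⇒Incomparable : ∀ {p q} → Encloses p q → Incomparable p q
Encloses⇒Incomparable (a<c , d<b) =
    (λ p≤q → <-irrefl refl (<-≤-trans d<b (proj₂ p≤q)))
  , (λ q≤p → <-irrefl refl (<-≤-trans a<c (proj₁ q≤p)))

Incomparable⇒Encloses : ∀ {p q} → proj₁ p < proj₁ q → Incomparable p q → Encloses p q
Incomparable⇒Encloses a<c (p≰q , _) = a<c , ≰⇒> (λ b≤d → p≰q (<⇒≤ a<c , b≤d))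

Chain : ℕ → List ℕ → ℕ → Set
Chain lo []       hi = lo < hi
Chain lo (x ∷ xs) hi = lo < x × Chain x xs hi

Chain⇒< : ∀ {lo hi} xs → Chain lo xs hi → lo < hi
Chain⇒< []       lo<hi          = lo<hi
Chain⇒< (x ∷ xs) (lo<x , chain) = <-trans lo<x (Chain⇒< xs chain)

Chain-weaken : ∀ {lo lo′ hi} xs → lo′ ≤ lo → Chain lo xs hi → Chain lo′ xs hi
Chain-weaken []       lo′≤lo lo<hi          = ≤-<-trans lo′≤lo lo<hi
Chain-weaken (x ∷ xs) lo′≤lo (lo<x , chain) = ≤-<-trans lo′≤lo lo<x , chain

Chain-++-∷⁻ : ∀ {a hi} xs b zs → Chain a (xs ++ b ∷ zs) hi → a < b × Chain b zs hi
Chain-++-∷⁻ []       b zs chain        = chain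
Chain-++-∷⁻ (x ∷ xs) b zs (a<x , chain) with Chain-++-∷⁻ xs b zs chain
... | x<b , chain′ = <-trans a<x x<b , chain′

headOr : List ℕ → ℕ → ℕ
headOr []      hi = hi
headOr (z ∷ _) _  = z

Chain⇒<headOr : ∀ {b hi} zs → Chain b zs hi → b < headOr zs hi
Chain⇒<headOr []      b<hi      = b<hi
Chain⇒<headOr (z ∷ _) (b<z , _) = b<z

Between : ℕ → ℕ → ℕ² → Set
Between lo hi (a , b) = lo < a × a < b × b < hi

-- The nested pairs (a₁ , b₁) ⊃ … ⊃ (aₖ , bₖ) are laid out as a₁ < … < aₖ < bₖ < … < b₁;
-- the accumulator zs holds the right ends already placed.
unfoldOnto : List ℕ² → List ℕ → List ℕ
unfoldOnto T zs = map proj₁ T ++ (map proj₂ T ʳ++ zs)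

unfold : List ℕ² → List ℕ
unfold T = unfoldOnto T []

unfoldOnto-≡ : ∀ T zs → unfoldOnto T zs ≡ unfold T ++ zs
unfoldOnto-≡ T zs = begin
  map proj₁ T ++ (map proj₂ T ʳ++ zs)        ≡⟨ cong (map proj₁ T ++_) (ʳ++-defn (map proj₂ T)) ⟩
  map proj₁ T ++ (reverse (map proj₂ T) ++ zs) ≡⟨ ++-assoc (map proj₁ T) _ _ ⟨
  unfold T ++ zs                             ∎

Chain-unfoldOnto⁺ : ∀ T {lo hi zs top} → lo < hi → All (Between lo hi) T → AllPairs Encloses T →
                    (∀ x → x < hi → Chain x zs top) → Chain lo (unfoldOnto T zs) top
Chain-unfoldOnto⁺ []            lo<hi _ _ zs-chain = zs-chain _ lo<hi
Chain-unfoldOnto⁺ ((a , b) ∷ T) _ ((lo<a , a<b , b<hi) ∷ between) (encl ∷ encls) zs-chain =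
  lo<a , Chain-unfoldOnto⁺ T a<b inner encls (λ x x<b → x<b , zs-chain b b<hi)
  where
  inner : All (Between a b) T
  inner = All.zipWith (λ { ((a<c , d<b) , (_ , c<d , _)) → a<c , c<d , d<b }) (encl , between)

Chain-unfoldOnto⁻ : ∀ T {lo zs top} → Chain lo (unfoldOnto T zs) top →
                    All (Between lo (headOr zs top)) T × AllPairs Encloses T
Chain-unfoldOnto⁻ []            _              = [] , []
Chain-unfoldOnto⁻ ((a , b) ∷ T) {lo} {zs} {top} (lo<a , chain)
  with Chain-unfoldOnto⁻ T chain
     | Chain-++-∷⁻ (unfold T) b zs (subst (λ l → Chain a l top) (unfoldOnto-≡ T (b ∷ zs)) chain)
... | between , encls | a<b , b-chain =
    ((lo<a , a<b , b<z) ∷ All.map widen between)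
  , All.map (λ { (a<c , _ , d<b) → a<c , d<b }) between ∷ encls
  where
  b<z = Chain⇒<headOr zs b-chain
  widen : ∀ {p} → Between a b p → Between lo (headOr zs top) p
  widen (a<c , c<d , d<b) = <-trans lo<a a<c , c<d , <-trans d<b b<z

fold : ℕ → List ℕ → List ℕ²
fold k L = zip (take k L) (reverse (drop k L))

module _ {A : Set} where

  take-++-length : ∀ (xs ys : List A) {n} → length xs ≡ n → take n (xs ++ ys) ≡ xs
  take-++-length []       ys refl = refl
  take-++-length (x ∷ xs) ys refl = cong (x ∷_) (take-++-length xs ys refl)

  drop-++-length : ∀ (xs ys : List A) {n} → length xs ≡ n → drop n (xs ++ ys) ≡ ys
  drop-++-length []       ys refl = refl
  drop-++-length (x ∷ xs) ys refl = drop-++-length xs ys refl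

  length-take-+ : ∀ (L : List A) k j → length L ≡ k + j → length (take k L) ≡ k
  length-take-+ L k j e = trans (length-take k L) (trans (cong (k ⊓_) e) (m≤n⇒m⊓n≡m (m≤m+n k j)))

  length-drop-+ : ∀ (L : List A) k j → length L ≡ k + j → length (drop k L) ≡ j
  length-drop-+ L k j e = trans (length-drop k L) (trans (cong (_∸ k) e) (m+n∸m≡n k j))

module _ {A B : Set} where

  map-proj₁-zip : ∀ (U : List A) (W : List B) → length U ≡ length W → map proj₁ (zip U W) ≡ U
  map-proj₁-zip []      []      _ = refl
  map-proj₁-zip (u ∷ U) (w ∷ W) e = cong (u ∷_) (map-proj₁-zip U W (suc-injective e))

  map-proj₂-zip : ∀ (U : List A) (W : List B) → length U ≡ length W → map proj₂ (zip U W) ≡ W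
  map-proj₂-zip []      []      _ = refl
  map-proj₂-zip (u ∷ U) (w ∷ W) e = cong (w ∷_) (map-proj₂-zip U W (suc-injective e))

  zip-map-proj : ∀ (T : List (A × B)) → zip (map proj₁ T) (map proj₂ T) ≡ T
  zip-map-proj []            = refl
  zip-map-proj ((a , b) ∷ T) = cong ((a , b) ∷_) (zip-map-proj T)

length-unfold : ∀ T → length (unfold T) ≡ length T + length T
length-unfold T = trans (length-++ (map proj₁ T))
  (cong₂ _+_ (length-map proj₁ T) (trans (length-reverse (map proj₂ T)) (length-map proj₂ T)))

fold-unfold : ∀ T {k} → length T ≡ k → fold k (unfold T) ≡ T
fold-unfold T {k} |T|≡k = begin
  zip (take k (firsts ++ reverse seconds)) (reverse (drop k (firsts ++ reverse seconds)))
    ≡⟨ cong₂ (λ U W → zip U (reverse W)) (take-++-length firsts _ |firsts|≡k)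
                                         (drop-++-length firsts _ |firsts|≡k) ⟩
  zip firsts (reverse (reverse seconds))
    ≡⟨ cong (zip firsts) (reverse-involutive seconds) ⟩
  zip firsts seconds
    ≡⟨ zip-map-proj T ⟩
  T ∎
  where
  firsts = map proj₁ T
  seconds = map proj₂ T
  |firsts|≡k = trans (length-map proj₁ T) |T|≡k

module _ (L : List ℕ) (k : ℕ) (|L|≡2k : length L ≡ k + k) where

  private
    U = take k L
    W = reverse (drop k L)

  length-take≡length-reverse-drop : length (take k L) ≡ length (reverse (drop k L))
  length-take≡length-reverse-drop = trans (length-take-+ L k k |L|≡2k)
                  (sym (trans (length-reverse (drop k L)) (length-drop-+ L k k |L|≡2k)))

  private
    |U|≡|W| = length-take≡length-reverse-drop

  unfold-fold : unfold (fold k L) ≡ L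
  unfold-fold = begin
    map proj₁ (zip U W) ++ reverse (map proj₂ (zip U W))
      ≡⟨ cong₂ (λ X Y → X ++ reverse Y) (map-proj₁-zip U W |U|≡|W|) (map-proj₂-zip U W |U|≡|W|) ⟩
    U ++ reverse (reverse (drop k L))
      ≡⟨ cong (U ++_) (reverse-involutive (drop k L)) ⟩
    U ++ drop k L
      ≡⟨ take++drop≡id k L ⟩
    L ∎

  length-fold : length (fold k L) ≡ k
  length-fold = begin
    length (zip U W)             ≡⟨ length-map proj₁ (zip U W) ⟨
    length (map proj₁ (zip U W)) ≡⟨ cong length (map-proj₁-zip U W |U|≡|W|) ⟩
    length U                     ≡⟨ length-take-+ L k k |L|≡2k ⟩
    k ∎

-- Antichains of C(m, 2) as 2k-subsets of [m]

Increasing : ∀ {n} → Vec ℕ n → Set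
Increasing {n} v = ∀ (i j : Fin n) → i F.< j → lookup v i < lookup v j

Bounded : ℕ → ℕ → ∀ {n} → Vec ℕ n → Set
Bounded lo hi v = ∀ i → lo < lookup v i × lookup v i < hi

Increasing∧Bounded⇒Chain : ∀ {n lo hi} (v : Vec ℕ n) → lo < hi → Increasing v → Bounded lo hi v →
                           Chain lo (toList v) hi
Increasing∧Bounded⇒Chain []      lo<hi _          _      = lo<hi
Increasing∧Bounded⇒Chain (x ∷ v) _     increasing bounds =
  proj₁ (bounds fz) ,
  Increasing∧Bounded⇒Chain v (proj₂ (bounds fz)) (λ i j i<j → increasing (fs i) (fs j) (s≤s i<j))
                             (λ i → increasing fz (fs i) (s≤s z≤n) , proj₂ (bounds (fs i)))

Chain⇒Increasing∧Bounded : ∀ {n lo hi} (v : Vec ℕ n) → Chain lo (toList v) hi →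
                           Increasing v × Bounded lo hi v
Chain⇒Increasing∧Bounded []      _              = (λ ()) , (λ ())
Chain⇒Increasing∧Bounded {hi = hi} (x ∷ v) (lo<x , chain) with Chain⇒Increasing∧Bounded v chain
... | increasing , bounds = increasing′ , bounds′
  where
  increasing′ : Increasing (x ∷ v)
  increasing′ fz     (fs j) _         = proj₁ (bounds j)
  increasing′ (fs i) (fs j) (s≤s i<j) = increasing i j i<j
  bounds′ : Bounded _ hi (x ∷ v)
  bounds′ fz     = lo<x , Chain⇒< (toList v) chain
  bounds′ (fs i) = <-trans lo<x (proj₁ (bounds i)) , proj₂ (bounds i)

IsCombo⇒Chain : ∀ {m n} (v : Vec ℕ n) → IsCombo m n v → Chain 0 (toList v) (suc m)
IsCombo⇒Chain v (bounds , increasing) =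
  Increasing∧Bounded⇒Chain v (s≤s z≤n) increasing (λ i → proj₁ (bounds i) , s≤s (proj₂ (bounds i)))

Chain⇒IsCombo : ∀ {m n} (v : Vec ℕ n) → Chain 0 (toList v) (suc m) → IsCombo m n v
Chain⇒IsCombo v chain with Chain⇒Increasing∧Bounded v chain
... | increasing , bounds = (λ i → proj₁ (bounds i) , ≤-pred (proj₂ (bounds i))) , increasing

module PairAntichains (m : ℕ) where

  CP : OrdStr
  CP = CPoset m 2

  C₂ : Set
  C₂ = Combo m 2

  pair : C₂ → ℕ²
  pair (x ∷ y ∷ [] , _) = x , y

  pair-injective : ∀ {c d : C₂} → pair c ≡ pair d → proj₁ c ≡ proj₁ d
  pair-injective {x ∷ y ∷ [] , _} {.x ∷ .y ∷ [] , _} refl = refl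

  pair-cong : ∀ {c d : C₂} → proj₁ c ≡ proj₁ d → pair c ≡ pair d
  pair-cong {x ∷ y ∷ [] , _} {.x ∷ .y ∷ [] , _} refl = refl

  ≤⇒≤² : ∀ {c d : C₂} → OrdStr._≤ₚ_ CP c d → pair c ≤² pair d
  ≤⇒≤² {x ∷ y ∷ [] , _} {x′ ∷ y′ ∷ [] , _} c≤d = c≤d fz , c≤d (fs fz)

  ≤²⇒≤ : ∀ {c d : C₂} → pair c ≤² pair d → OrdStr._≤ₚ_ CP c d
  ≤²⇒≤ {x ∷ y ∷ [] , _} {x′ ∷ y′ ∷ [] , _} (x≤x′ , _)    fz      = x≤x′
  ≤²⇒≤ {x ∷ y ∷ [] , _} {x′ ∷ y′ ∷ [] , _} (_    , y≤y′) (fs fz) = y≤y′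

  Valid : ℕ² → Set
  Valid = Between 0 (suc m)

  pair-valid : ∀ c → Valid (pair c)
  pair-valid (x ∷ y ∷ [] , bounds , increasing) =
    proj₁ (bounds fz) , increasing fz (fs fz) (s≤s z≤n) , s≤s (proj₂ (bounds (fs fz)))

  fromPair : ∀ p → Valid p → C₂
  fromPair (a , b) valid = a ∷ b ∷ [] , Chain⇒IsCombo (a ∷ b ∷ []) valid

  pairs : ∀ {k} → Vec C₂ k → List ℕ²
  pairs []      = []
  pairs (c ∷ v) = pair c ∷ pairs v

  length-pairs : ∀ {k} (v : Vec C₂ k) → length (pairs v) ≡ k
  length-pairs []      = refl
  length-pairs (c ∷ v) = cong suc (length-pairs v)

  ∈-pairs⁺ : ∀ {k} (v : Vec C₂ k) i → pair (lookup v i) ∈ pairs v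
  ∈-pairs⁺ (c ∷ v) fz     = here refl
  ∈-pairs⁺ (c ∷ v) (fs i) = there (∈-pairs⁺ v i)

  ∈-pairs⁻ : ∀ {k} (v : Vec C₂ k) {p} → p ∈ pairs v → ∃ λ i → p ≡ pair (lookup v i)
  ∈-pairs⁻ (c ∷ v) (here e)  = fz , e
  ∈-pairs⁻ (c ∷ v) (there m) with ∈-pairs⁻ v m
  ... | i , e = fs i , e

  pairs-valid : ∀ {k} (v : Vec C₂ k) → All Valid (pairs v)
  pairs-valid []      = []
  pairs-valid (c ∷ v) = pair-valid c ∷ pairs-valid v

  ∈A⇒∈-pairs : ∀ {k} (A : Antichain CP k) {c} → _∈A_ CP c A → pair c ∈ pairs (proj₁ A)
  ∈A⇒∈-pairs (v , _) {c} (i , e) = subst (_∈ pairs v) (sym (pair-cong {c} {lookup v i} e)) (∈-pairs⁺ v i)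

  ∈-pairs⇒∈A : ∀ {k} (A : Antichain CP k) {c} → pair c ∈ pairs (proj₁ A) → _∈A_ CP c A
  ∈-pairs⇒∈A (v , _) {c} m with ∈-pairs⁻ v m
  ... | i , e = i , pair-injective {c} {lookup v i} e

  IsAntichain⇒Incomparable : ∀ {k} (v : Vec C₂ k) → IsAntichain CP k v → AllPairs Incomparable (pairs v)
  IsAntichain⇒Incomparable []      _    = []
  IsAntichain⇒Incomparable (c ∷ v) anti =
    All.tabulate incomparable
    ∷ IsAntichain⇒Incomparable v (λ i j i≢j → anti (fs i) (fs j) (λ e → i≢j (F.suc-injective e)))
    where
    incomparable : ∀ {p} → p ∈ pairs v → Incomparable (pair c) p
    incomparable m with ∈-pairs⁻ v m
    ... | j , refl = (λ c≤ → proj₂ (anti fz (fs j) (λ ())) (≤²⇒≤ {c} {lookup v j} c≤))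
                   , (λ ≤c → proj₂ (anti (fs j) fz (λ ())) (≤²⇒≤ {lookup v j} {c} ≤c))

  Incomparable⇒IsAntichain : ∀ {k} (v : Vec C₂ k) → AllPairs Incomparable (pairs v) → IsAntichain CP k v
  Incomparable⇒IsAntichain (c ∷ v) _ fz fz i≢j = ⊥-elim (i≢j refl)
  Incomparable⇒IsAntichain (c ∷ v) (c∥v ∷ _) fz (fs j) _ =
      (λ e → proj₁ c∥vⱼ (subst (pair c ≤²_) (pair-cong {c} {lookup v j} e) (≤-refl , ≤-refl)))
    , (λ c≤ → proj₁ c∥vⱼ (≤⇒≤² {c} {lookup v j} c≤))
    where c∥vⱼ = All.lookup c∥v (∈-pairs⁺ v j)
  Incomparable⇒IsAntichain (c ∷ v) (c∥v ∷ _) (fs i) fz _ =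
      (λ e → proj₂ c∥vᵢ (subst (pair (lookup v i) ≤²_) (pair-cong {lookup v i} {c} e) (≤-refl , ≤-refl)))
    , (λ ≤c → proj₂ c∥vᵢ (≤⇒≤² {lookup v i} {c} ≤c))
    where c∥vᵢ = All.lookup c∥v (∈-pairs⁺ v i)
  Incomparable⇒IsAntichain (c ∷ v) (_ ∷ v∥) (fs i) (fs j) i≢j =
    Incomparable⇒IsAntichain v v∥ i j (λ e → i≢j (cong fs e))

  fromPairs : (T : List ℕ²) → All Valid T → ∀ {k} → length T ≡ k → Vec C₂ k
  fromPairs []      []              refl = []
  fromPairs (p ∷ T) (valid ∷ valids) refl = fromPair p valid ∷ fromPairs T valids refl

  pairs-fromPairs : ∀ T valids {k} (e : length T ≡ k) → pairs (fromPairs T valids e) ≡ T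
  pairs-fromPairs []            []       refl = refl
  pairs-fromPairs ((a , b) ∷ T) (_ ∷ valids) refl = cong ((a , b) ∷_) (pairs-fromPairs T valids refl)

  antichainFromPairs : ∀ {k} (T : List ℕ²) → All Valid T → AllPairs Incomparable T → length T ≡ k →
                       Antichain CP k
  antichainFromPairs T valids T∥ e =
    v , Incomparable⇒IsAntichain v (subst (AllPairs Incomparable) (sym (pairs-fromPairs T valids e)) T∥)
    where v = fromPairs T valids e

  ≈A-pairs : ∀ {k} (A B : Antichain CP k) → pairs (proj₁ A) ⊆ pairs (proj₁ B) →
             pairs (proj₁ B) ⊆ pairs (proj₁ A) → _≈A_ CP A B
  ≈A-pairs A B A⊆B B⊆A c = (λ m → ∈-pairs⇒∈A B {c} (A⊆B (∈A⇒∈-pairs A {c} m)))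
                         , (λ m → ∈-pairs⇒∈A A {c} (B⊆A (∈A⇒∈-pairs B {c} m)))

  ≈A⇒⊆ : ∀ {k} (A B : Antichain CP k) → _≈A_ CP A B → pairs (proj₁ A) ⊆ pairs (proj₁ B)
  ≈A⇒⊆ A B A≈B m with ∈-pairs⁻ (proj₁ A) m
  ... | i , refl = ∈A⇒∈-pairs B {lookup (proj₁ A) i} (proj₁ (A≈B (lookup (proj₁ A) i)) (i , refl))

module SortPairs = SortBy {ℕ²} proj₁

toList-injective′ : ∀ {A : Set} {n} (xs ys : Vec A n) → toList xs ≡ toList ys → xs ≡ ys
toList-injective′ xs ys e = trans (sym (cast-is-id refl xs)) (toList-injective refl xs ys e)

module AntichainsAsCombos (m k : ℕ) where
  open PairAntichains m public

  𝒜ₖ : Set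
  𝒜ₖ = Antichain CP k

  C₂ₖ : Set
  C₂ₖ = Combo m (2 * k)

  2k≡k+k : 2 * k ≡ k + k
  2k≡k+k = cong (k +_) (+-identityʳ k)

  pairsOf : 𝒜ₖ → List ℕ²
  pairsOf A = pairs (proj₁ A)

  pairsOf-Incomparable : ∀ A → AllPairs Incomparable (pairsOf A)
  pairsOf-Incomparable (v , anti) = IsAntichain⇒Incomparable v anti

  pairsOf-DistinctKeys : ∀ A → SortPairs.DistinctKeys (pairsOf A)
  pairsOf-DistinctKeys A = AllPairs.map Incomparable⇒proj₁≢ (pairsOf-Incomparable A)

  nested : 𝒜ₖ → List ℕ²
  nested A = SortPairs.sort (pairsOf A)

  nested-sorted : ∀ A → SortPairs.Sorted (nested A)
  nested-sorted A = SortPairs.sort-sorted (pairsOf A) (pairsOf-DistinctKeys A)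

  nested-Encloses : ∀ A → AllPairs Encloses (nested A)
  nested-Encloses A = AllPairs.zipWith (λ (p∥q , p<q) → Incomparable⇒Encloses p<q p∥q)
    (SortPairs.AllPairs-sort Incomparable-sym (pairsOf-Incomparable A) , nested-sorted A)

  nested-valid : ∀ A → All Valid (nested A)
  nested-valid A = All.tabulate (λ p∈ → All.lookup (pairs-valid (proj₁ A)) (SortPairs.∈-sort⁻ _ p∈))

  length-nested : ∀ A → length (nested A) ≡ k
  length-nested A = trans (SortPairs.length-sort (pairsOf A)) (length-pairs (proj₁ A))

  length-unfold-nested : ∀ A → length (unfold (nested A)) ≡ 2 * k
  length-unfold-nested A = trans (length-unfold (nested A))
    (trans (cong (λ n → n + n) (length-nested A)) (sym 2k≡k+k))

  toVec : 𝒜ₖ → Vec ℕ (2 * k)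
  toVec A = cast (length-unfold-nested A) (fromList (unfold (nested A)))

  toList-toVec : ∀ A → toList (toVec A) ≡ unfold (nested A)
  toList-toVec A = trans (toList-cast (length-unfold-nested A) _) (toList∘fromList _)

  toCombo : 𝒜ₖ → C₂ₖ
  toCombo A = toVec A , Chain⇒IsCombo (toVec A)
    (subst (λ l → Chain 0 l (suc m)) (sym (toList-toVec A))
      (Chain-unfoldOnto⁺ (nested A) (s≤s z≤n) (nested-valid A) (nested-Encloses A) (λ _ x<hi → x<hi)))

  foldCombo : C₂ₖ → List ℕ²
  foldCombo x = fold k (toList (proj₁ x))

  length-toList-combo : ∀ (x : C₂ₖ) → length (toList (proj₁ x)) ≡ k + k
  length-toList-combo x = trans (length-toList (proj₁ x)) 2k≡k+k

  unfold-foldCombo : ∀ x → unfold (foldCombo x) ≡ toList (proj₁ x)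
  unfold-foldCombo x = unfold-fold (toList (proj₁ x)) k (length-toList-combo x)

  foldCombo-nested : ∀ x → All Valid (foldCombo x) × AllPairs Encloses (foldCombo x)
  foldCombo-nested x = Chain-unfoldOnto⁻ (foldCombo x)
    (subst (λ l → Chain 0 l (suc m)) (sym (unfold-foldCombo x)) (IsCombo⇒Chain (proj₁ x) (proj₂ x)))

  length-foldCombo : ∀ x → length (foldCombo x) ≡ k
  length-foldCombo x = length-fold (toList (proj₁ x)) k (length-toList-combo x)

  fromCombo : C₂ₖ → 𝒜ₖ
  fromCombo x = antichainFromPairs (foldCombo x) (proj₁ (foldCombo-nested x))
    (AllPairs.map Encloses⇒Incomparable (proj₂ (foldCombo-nested x))) (length-foldCombo x)

  pairsOf-fromCombo : ∀ x → pairsOf (fromCombo x) ≡ foldCombo x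
  pairsOf-fromCombo x = pairs-fromPairs (foldCombo x) (proj₁ (foldCombo-nested x)) (length-foldCombo x)

  nested-fromCombo : ∀ x → nested (fromCombo x) ≡ foldCombo x
  nested-fromCombo x = trans (cong SortPairs.sort (pairsOf-fromCombo x))
    (SortPairs.sort-Sorted (AllPairs.map proj₁ (proj₂ (foldCombo-nested x))))

  toCombo-cong : ∀ {A B} → _≈A_ CP A B → toVec A ≡ toVec B
  toCombo-cong {A} {B} A≈B = toList-injective′ _ _ (begin
    toList (toVec A)     ≡⟨ toList-toVec A ⟩
    unfold (nested A)    ≡⟨ cong unfold nested≡ ⟩
    unfold (nested B)    ≡⟨ toList-toVec B ⟨
    toList (toVec B)     ∎)
    where
    nested≡ : nested A ≡ nested B
    nested≡ = SortPairs.sorted-≡-sort (nested-sorted A) (pairsOf-DistinctKeys B)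
      (λ m → ≈A⇒⊆ A B A≈B (SortPairs.∈-sort⁻ (pairsOf A) m))
      (λ m → SortPairs.∈-sort⁺ (pairsOf A) (≈A⇒⊆ B A (≈A-sym {CP} {A = A} {B} A≈B) m))

  fromCombo-cong : ∀ {x y : C₂ₖ} → proj₁ x ≡ proj₁ y → _≈A_ CP (fromCombo x) (fromCombo y)
  fromCombo-cong {x} {y} x≡y =
    ≈A-pairs (fromCombo x) (fromCombo y) (Subset.⊆-reflexive pairs≡) (Subset.⊆-reflexive (sym pairs≡))
    where
    pairs≡ : pairsOf (fromCombo x) ≡ pairsOf (fromCombo y)
    pairs≡ = trans (pairsOf-fromCombo x)
               (trans (cong (λ v → fold k (toList v)) x≡y) (sym (pairsOf-fromCombo y)))

  fromCombo-toCombo : ∀ A → _≈A_ CP (fromCombo (toCombo A)) A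
  fromCombo-toCombo A = ≈A-pairs (fromCombo (toCombo A)) A
    (λ m → SortPairs.∈-sort⁻ (pairsOf A) (subst (_ ∈_) pairs≡ m))
    (λ m → subst (_ ∈_) (sym pairs≡) (SortPairs.∈-sort⁺ (pairsOf A) m))
    where
    pairs≡ : pairsOf (fromCombo (toCombo A)) ≡ nested A
    pairs≡ = begin
      pairsOf (fromCombo (toCombo A)) ≡⟨ pairsOf-fromCombo (toCombo A) ⟩
      fold k (toList (toVec A))       ≡⟨ cong (fold k) (toList-toVec A) ⟩
      fold k (unfold (nested A))      ≡⟨ fold-unfold (nested A) (length-nested A) ⟩
      nested A                        ∎

  toCombo-fromCombo : ∀ x → toVec (fromCombo x) ≡ proj₁ x
  toCombo-fromCombo x = toList-injective′ _ _ (begin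
    toList (toVec (fromCombo x))    ≡⟨ toList-toVec (fromCombo x) ⟩
    unfold (nested (fromCombo x))   ≡⟨ cong unfold (nested-fromCombo x) ⟩
    unfold (foldCombo x)            ≡⟨ unfold-foldCombo x ⟩
    toList (proj₁ x)                ∎)

-- Comparing the orders

Pointwise⇒lookup : ∀ {n} (u v : Vec ℕ n) → Pointwise _≤_ (toList u) (toList v) →
                   ∀ i → lookup u i ≤ lookup v i
Pointwise⇒lookup (x ∷ u) (y ∷ v) (x≤y ∷ _)  fz     = x≤y
Pointwise⇒lookup (x ∷ u) (y ∷ v) (_ ∷ u≤v) (fs i) = Pointwise⇒lookup u v u≤v i

module Monotonicity (m k : ℕ) where
  open AntichainsAsCombos m k
  open import Data.List.Membership.DecPropositional _≟²_ using (_∈?_)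

  record Exchange (A B : 𝒜ₖ) : Set where
    field
      old new    : ℕ²
      old≤new    : old ≤² new
      rest       : List ℕ²
      A⊆old∷rest : pairsOf A ⊆ old ∷ rest
      old∷rest⊆A : old ∷ rest ⊆ pairsOf A
      B⊆new∷rest : pairsOf B ⊆ new ∷ rest
      new∷rest⊆B : new ∷ rest ⊆ pairsOf B
      old∷rest-∥ : AllPairs Incomparable (old ∷ rest)
      new∷rest-∥ : AllPairs Incomparable (new ∷ rest)

  ≺⇒Exchange : ∀ {A B} → _≺A_ CP A B → Exchange A B
  ≺⇒Exchange {A} {B} (a , b , a∈A , a∉B , b∈B , b∉A , onlyA , onlyB , a≤b , _) = record
    { old = pair a ; new = pair b ; old≤new = ≤⇒≤² {a} {b} a≤b ; rest = rest
    ; A⊆old∷rest = A⊆ ; old∷rest⊆A = ⊆A ; B⊆new∷rest = B⊆ ; new∷rest⊆B = ⊆B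
    ; old∷rest-∥ = AllPairs-∷ Incomparable-sym (pairsOf-Incomparable A) a∈A′ rest⊆A
                     rest≢a rest-∥
    ; new∷rest-∥ = AllPairs-∷ Incomparable-sym (pairsOf-Incomparable B) b∈B′ rest⊆B
                     (All.tabulate (λ z∈ z≡b → b∉A (∈-pairs⇒∈A A {b} (subst (_∈ _) z≡b (rest⊆A z∈)))))
                     rest-∥
    }
    where
    rest = filter (_≢? pair a) (pairsOf A)
    a∈A′ = ∈A⇒∈-pairs A {a} a∈A
    b∈B′ = ∈A⇒∈-pairs B {b} b∈B
    ∈-rest⁻ : ∀ {z} → z ∈ rest → z ∈ pairsOf A × z ≢ pair a
    ∈-rest⁻ = ∈-filter⁻ (_≢? pair a) {xs = pairsOf A}
    rest⊆A : rest ⊆ pairsOf A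
    rest⊆A z∈ = proj₁ (∈-rest⁻ z∈)
    rest≢a : All (_≢ pair a) rest
    rest≢a = All.tabulate (λ z∈ → proj₂ (∈-rest⁻ z∈))
    rest-∥ : AllPairs Incomparable rest
    rest-∥ = AllPairs.filter⁺ (_≢? pair a) (pairsOf-Incomparable A)
    A⊆ : pairsOf A ⊆ pair a ∷ rest
    A⊆ {z} z∈ with z ≟² pair a
    ... | yes z≡a = here z≡a
    ... | no  z≢a = there (∈-filter⁺ (_≢? pair a) z∈ z≢a)
    ⊆A : pair a ∷ rest ⊆ pairsOf A
    ⊆A (here refl) = a∈A′
    ⊆A (there z∈)  = rest⊆A z∈
    B⊆ : pairsOf B ⊆ pair b ∷ rest
    B⊆ {z} z∈ with z ∈? pairsOf A
    ... | yes z∈A = there (∈-filter⁺ (_≢? pair a) z∈A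
                            (λ z≡a → a∉B (∈-pairs⇒∈A B {a} (subst (_∈ pairsOf B) z≡a z∈))))
    ... | no z∉A with ∈-pairs⁻ (proj₁ B) z∈
    ...   | j , refl = here (pair-cong {c} {b} (onlyB c (j , refl) (λ c∈A → z∉A (∈A⇒∈-pairs A {c} c∈A))))
      where c = lookup (proj₁ B) j
    ⊆B : pair b ∷ rest ⊆ pairsOf B
    ⊆B (here refl) = b∈B′
    ⊆B {z} (there z∈) with z ∈? pairsOf B
    ... | yes z∈B = z∈B
    ... | no  z∉B with ∈-pairs⁻ (proj₁ A) (rest⊆A z∈)
    ...   | i , refl = ⊥-elim (All.lookup rest≢a z∈
                           (pair-cong {c} {a} (onlyA c (i , refl) (λ c∈B → z∉B (∈A⇒∈-pairs B {c} c∈B)))))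
      where c = lookup (proj₁ A) i
    rest⊆B : rest ⊆ pairsOf B
    rest⊆B z∈ = ⊆B (there z∈)

  unfold-nested : ∀ A {Y} → pairsOf A ⊆ Y → Y ⊆ pairsOf A → AllPairs Incomparable Y →
                  unfold (nested A) ≡ SortNat.sort (map proj₁ Y) ++ SortNat.sort (map proj₂ Y)
  unfold-nested A {Y} A⊆Y Y⊆A Y-∥ = cong₂ _++_
    (SortNat.sorted-≡-sort (AllPairs.map⁺ (nested-sorted A))
      (AllPairs.map⁺ (AllPairs.map Incomparable⇒proj₁≢ Y-∥))
      (Subset.map⁺ proj₁ (A⊆Y ∘ ∈-nested⁻))
      (Subset.map⁺ proj₁ (∈-nested⁺ ∘ Y⊆A)))
    (SortNat.sorted-≡-sort (AllPairs-reverse (AllPairs.map⁺ (AllPairs.map proj₂ (nested-Encloses A))))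
      (AllPairs.map⁺ (AllPairs.map Incomparable⇒proj₂≢ Y-∥))
      (Subset.map⁺ proj₂ (A⊆Y ∘ ∈-nested⁻) ∘ Any.reverse⁻)
      (Any.reverse⁺ ∘ Subset.map⁺ proj₂ (∈-nested⁺ ∘ Y⊆A)))
    where
    ∈-nested⁻ : nested A ⊆ pairsOf A
    ∈-nested⁻ = SortPairs.∈-sort⁻ (pairsOf A)
    ∈-nested⁺ : pairsOf A ⊆ nested A
    ∈-nested⁺ = SortPairs.∈-sort⁺ (pairsOf A)

  Exchange⇒≤ : ∀ {A B} → Exchange A B → Pointwise _≤_ (unfold (nested A)) (unfold (nested B))
  Exchange⇒≤ {A} {B} ex =
    subst₂ (Pointwise _≤_)
      (sym (unfold-nested A A⊆old∷rest old∷rest⊆A old∷rest-∥))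
      (sym (unfold-nested B B⊆new∷rest new∷rest⊆B new∷rest-∥))
      (Pointwise.++⁺ (insert-mono _ (proj₁ old≤new) (sorted proj₁ Incomparable⇒proj₁≢))
                     (insert-mono _ (proj₂ old≤new) (sorted proj₂ Incomparable⇒proj₂≢)))
    where
    open Exchange ex
    rest-∥ = AllPairs.tail old∷rest-∥
    sorted : ∀ (π : ℕ² → ℕ) → (∀ {p q} → Incomparable p q → π p ≢ π q) →
             SortNat.Sorted (SortNat.sort (map π rest))
    sorted π π≢ = SortNat.sort-sorted (map π rest) (AllPairs.map⁺ (AllPairs.map π≢ rest-∥))

  toCombo-mono : ∀ {A B} → _≤A_ CP A B → ∀ i → lookup (toVec A) i ≤ lookup (toVec B) i
  toCombo-mono ε i = ≤-refl
  toCombo-mono {A} (_◅_ {j = C} (inj₁ A≈C) C≤B) i =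
    subst (λ v → lookup v i ≤ _) (sym (toCombo-cong {A} {C} A≈C)) (toCombo-mono C≤B i)
  toCombo-mono {A} (_◅_ {j = C} (inj₂ A≺C) C≤B) i =
    ≤-trans (Pointwise⇒lookup (toVec A) (toVec C) A≤C i) (toCombo-mono C≤B i)
    where
    A≤C : Pointwise _≤_ (toList (toVec A)) (toList (toVec C))
    A≤C = subst₂ (Pointwise _≤_) (sym (toList-toVec A)) (sym (toList-toVec C))
            (Exchange⇒≤ {A} {C} (≺⇒Exchange {A} {C} A≺C))

data ReplaceOne {A : Set} (R : A → A → Set) : List A → List A → Set where
  here  : ∀ {x y l} → R x y → ReplaceOne R (x ∷ l) (y ∷ l)
  there : ∀ {x l l′} → ReplaceOne R l l′ → ReplaceOne R (x ∷ l) (x ∷ l′)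

module _ {A : Set} {R : A → A → Set} where

  ReplaceOne-take-drop : ∀ k {L L′} → ReplaceOne R L L′ →
    (ReplaceOne R (take k L) (take k L′) × drop k L ≡ drop k L′) ⊎
    (take k L ≡ take k L′ × ReplaceOne R (drop k L) (drop k L′))
  ReplaceOne-take-drop zero    r          = inj₂ (refl , r)
  ReplaceOne-take-drop (suc k) (here r)   = inj₁ (here r , refl)
  ReplaceOne-take-drop (suc k) (there {x = x} r) with ReplaceOne-take-drop k r
  ... | inj₁ (r′ , e) = inj₁ (there r′ , e)
  ... | inj₂ (e , r′) = inj₂ (cong (x ∷_) e , r′)

  ReplaceOne-ʳ++ : ∀ {xs ys} → ReplaceOne R xs ys → ∀ acc → ReplaceOne R (xs ʳ++ acc) (ys ʳ++ acc)
  ReplaceOne-ʳ++ (here {l = l} r) acc = unchanged l (here r)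
    where
    unchanged : ∀ zs {acc acc′} → ReplaceOne R acc acc′ → ReplaceOne R (zs ʳ++ acc) (zs ʳ++ acc′)
    unchanged []       r′ = r′
    unchanged (z ∷ zs) r′ = unchanged zs (there r′)
  ReplaceOne-ʳ++ (there {x = x} r) acc = ReplaceOne-ʳ++ r (x ∷ acc)

  ReplaceOne-reverse : ∀ {xs ys} → ReplaceOne R xs ys → ReplaceOne R (reverse xs) (reverse ys)
  ReplaceOne-reverse r = ReplaceOne-ʳ++ r []

  ReplaceOne-difference : (∀ {x y} → R x y → x ≢ y) → ∀ {xs ys} → Unique xs → Unique ys →
    ReplaceOne R xs ys → ∃₂ λ x y → R x y × x ∈ xs × x ∉ ys × y ∈ ys × y ∉ xs
      × (∀ {z} → z ∈ xs → z ∉ ys → z ≡ x) × (∀ {z} → z ∈ ys → z ∉ xs → z ≡ y)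
  ReplaceOne-difference R⇒≢ (x≢l ∷ _) (y≢l ∷ _) (here {x} {y} r) =
    x , y , r , here refl , ∉ys , here refl , ∉xs , onlyx , onlyy
    where
    ∉ys : x ∉ y ∷ _
    ∉ys (here x≡y) = R⇒≢ r x≡y
    ∉ys (there x∈l) = All.lookup x≢l x∈l refl
    ∉xs : y ∉ x ∷ _
    ∉xs (here y≡x) = R⇒≢ r (sym y≡x)
    ∉xs (there y∈l) = All.lookup y≢l y∈l refl
    onlyx : ∀ {z} → z ∈ x ∷ _ → z ∉ y ∷ _ → z ≡ x
    onlyx (here z≡x)  _  = z≡x
    onlyx (there z∈l) z∉ = ⊥-elim (z∉ (there z∈l))
    onlyy : ∀ {z} → z ∈ y ∷ _ → z ∉ x ∷ _ → z ≡ y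
    onlyy (here z≡y)  _  = z≡y
    onlyy (there z∈l) z∉ = ⊥-elim (z∉ (there z∈l))
  ReplaceOne-difference R⇒≢ (w≢l ∷ l!) (w≢l′ ∷ l′!) (there {x = w} r)
    with ReplaceOne-difference R⇒≢ l! l′! r
  ... | x , y , rxy , x∈l , x∉l′ , y∈l′ , y∉l , onlyx , onlyy =
      x , y , rxy
    , there x∈l , ∉-∷ x∉l′ (≢w w≢l x∈l) , there y∈l′ , ∉-∷ y∉l (≢w w≢l′ y∈l′)
    , onlyx′ , onlyy′
    where
    ≢w : ∀ {l z} → All (w ≢_) l → z ∈ l → z ≢ w
    ≢w w≢ z∈ z≡w = All.lookup w≢ z∈ (sym z≡w)
    ∉-∷ : ∀ {z l} → z ∉ l → z ≢ w → z ∉ w ∷ l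
    ∉-∷ z∉l z≢w (here z≡w)  = z≢w z≡w
    ∉-∷ z∉l z≢w (there z∈l) = z∉l z∈l
    onlyx′ : ∀ {z} → z ∈ w ∷ _ → z ∉ w ∷ _ → z ≡ x
    onlyx′ (here z≡w)  z∉ = ⊥-elim (z∉ (here z≡w))
    onlyx′ (there z∈l) z∉ = onlyx z∈l (λ z∈l′ → z∉ (there z∈l′))
    onlyy′ : ∀ {z} → z ∈ w ∷ _ → z ∉ w ∷ _ → z ≡ y
    onlyy′ (here z≡w)  z∉ = ⊥-elim (z∉ (here z≡w))
    onlyy′ (there z∈l) z∉ = onlyy z∈l (λ z∈l′ → z∉ (there z∈l′))

Succ : ℕ → ℕ → Set
Succ x y = y ≡ suc x

data Step² : ℕ² → ℕ² → Set where
  left  : ∀ {a b} → Step² (a , b) (suc a , b)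
  right : ∀ {a b} → Step² (a , b) (a , suc b)

Step²⇒≤² : ∀ {p q} → Step² p q → p ≤² q
Step²⇒≤² {a , b} left  = n≤1+n a , ≤-refl
Step²⇒≤² {a , b} right = ≤-refl , n≤1+n b

Step²⇒≢ : ∀ {p q} → Step² p q → p ≢ q
Step²⇒≢ left  e = <-irrefl (cong proj₁ e) (n<1+n _)
Step²⇒≢ right e = <-irrefl (cong proj₂ e) (n<1+n _)

ReplaceOne-zipˡ : ∀ {U U′ W : List ℕ} → ReplaceOne Succ U U′ → length U ≡ length W →
                  ReplaceOne Step² (zip U W) (zip U′ W)
ReplaceOne-zipˡ {W = w ∷ W} (here refl) _ = here left
ReplaceOne-zipˡ {W = w ∷ W} (there r)   e = there (ReplaceOne-zipˡ r (suc-injective e))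

ReplaceOne-zipʳ : ∀ {U W W′ : List ℕ} → ReplaceOne Succ W W′ → length U ≡ length W →
                  ReplaceOne Step² (zip U W) (zip U W′)
ReplaceOne-zipʳ {U = u ∷ U} (here refl) _ = here right
ReplaceOne-zipʳ {U = u ∷ U} (there r)   e = there (ReplaceOne-zipʳ r (suc-injective e))

ReplaceOne-fold : ∀ k {L L′} → length L ≡ k + k →
                  ReplaceOne Succ L L′ → ReplaceOne Step² (fold k L) (fold k L′)
ReplaceOne-fold k {L} {L′} |L|≡2k r with ReplaceOne-take-drop k r
... | inj₁ (r′ , e) = subst (λ d → ReplaceOne Step² (fold k L) (zip (take k L′) (reverse d))) e
                        (ReplaceOne-zipˡ r′ (length-take≡length-reverse-drop L k |L|≡2k))
... | inj₂ (e , r′) = subst (λ t → ReplaceOne Step² (fold k L) (zip t (reverse (drop k L′)))) e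
                        (ReplaceOne-zipʳ (ReplaceOne-reverse r′) (length-take≡length-reverse-drop L k |L|≡2k))

ChainStep : ℕ → ℕ → ∀ {n} → Vec ℕ n → Vec ℕ n → Set
ChainStep lo hi v w = ReplaceOne Succ (toList v) (toList w) × Chain lo (toList w) hi

bump-head : ∀ {n lo hi} (ws : Vec ℕ n) {a b} → a ≤′ b → lo < a → Chain b (toList ws) hi →
            Star (ChainStep lo hi) (a ∷ ws) (b ∷ ws)
bump-head ws ≤′-refl            _    _       = ε
bump-head ws {a} (≤′-step {b} a≤′b) lo<a 1+b-chain =
  bump-head ws a≤′b lo<a (Chain-weaken (toList ws) (n≤1+n b) 1+b-chain)
  ◅◅ ((here refl , <-≤-trans lo<a (≤-trans (≤′⇒≤ a≤′b) (n≤1+n b)) , 1+b-chain) ◅ ε)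

-- First raise the tail (still above the old head a), then raise the head.
chain-steps : ∀ {n lo hi} (v w : Vec ℕ n) → Chain lo (toList v) hi → Chain lo (toList w) hi →
              (∀ i → lookup v i ≤ lookup w i) → Star (ChainStep lo hi) v w
chain-steps []      []      _ _ _ = ε
chain-steps (a ∷ v) (b ∷ w) (lo<a , v-chain) (lo<b , w-chain) v≤w =
  gmap (a ∷_) (λ (r , chain) → there r , lo<a , chain)
    (chain-steps v w v-chain (Chain-weaken (toList w) (v≤w fz) w-chain) (λ i → v≤w (fs i)))
  ◅◅ bump-head w (≤⇒≤′ (v≤w fz)) lo<a w-chain

module Reflection (m k : ℕ) where
  open AntichainsAsCombos m k

  pairsOf-Unique : ∀ A → Unique (pairsOf A)
  pairsOf-Unique A = AllPairs.map Incomparable⇒≢ (pairsOf-Incomparable A)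

  ReplaceOne⇒≺ : ∀ A B → ReplaceOne Step² (pairsOf A) (pairsOf B) → _≺A_ CP A B
  ReplaceOne⇒≺ A B r
    with ReplaceOne-difference Step²⇒≢ (pairsOf-Unique A) (pairsOf-Unique B) r
  ... | x , y , x→y , x∈A , x∉B , y∈B , y∉A , onlyx , onlyy
    with ∈-pairs⁻ (proj₁ A) x∈A | ∈-pairs⁻ (proj₁ B) y∈B
  ... | i , refl | j , refl =
      a , b
    , (i , refl) , (λ a∈B → x∉B (∈A⇒∈-pairs B {a} a∈B))
    , (j , refl) , (λ b∈A → y∉A (∈A⇒∈-pairs A {b} b∈A))
    , (λ c c∈A c∉B → pair-injective {c} {a}
                       (onlyx (∈A⇒∈-pairs A {c} c∈A) (λ p∈ → c∉B (∈-pairs⇒∈A B {c} p∈))))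
    , (λ c c∈B c∉A → pair-injective {c} {b}
                       (onlyy (∈A⇒∈-pairs B {c} c∈B) (λ p∈ → c∉A (∈-pairs⇒∈A A {c} p∈))))
    , ≤²⇒≤ {a} {b} (Step²⇒≤² x→y) , (λ a≈b → Step²⇒≢ x→y (pair-cong {a} {b} a≈b))
    where
    a = lookup (proj₁ A) i
    b = lookup (proj₁ B) j

  fromCombo-step : ∀ (x y : C₂ₖ) → ReplaceOne Succ (toList (proj₁ x)) (toList (proj₁ y)) →
                   _≺A_ CP (fromCombo x) (fromCombo y)
  fromCombo-step x y r = ReplaceOne⇒≺ (fromCombo x) (fromCombo y)
    (subst₂ (ReplaceOne Step²) (sym (pairsOf-fromCombo x)) (sym (pairsOf-fromCombo y))
      (ReplaceOne-fold k (length-toList-combo x) r))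

  fromCombo-steps : ∀ {v w} → Star (ChainStep 0 (suc m)) v w → (x : C₂ₖ) → proj₁ x ≡ v →
                    (y : C₂ₖ) → proj₁ y ≡ w → _≤A_ CP (fromCombo x) (fromCombo y)
  fromCombo-steps ε x refl y y≡x = inj₁ (fromCombo-cong {x} {y} (sym y≡x)) ◅ ε
  fromCombo-steps (_◅_ {j = u} (r , chain) steps) x refl y y≡w =
    inj₂ (fromCombo-step x z r) ◅ fromCombo-steps steps z refl y y≡w
    where
    z : C₂ₖ
    z = u , Chain⇒IsCombo u chain

  toCombo-reflects : ∀ {A B} → (∀ i → lookup (toVec A) i ≤ lookup (toVec B) i) → _≤A_ CP A B
  toCombo-reflects {A} {B} A≤B =
    inj₁ (≈A-sym {CP} {A = fromCombo (toCombo A)} {A} (fromCombo-toCombo A))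
    ◅ (fromCombo-steps (chain-steps (toVec A) (toVec B) (chain A) (chain B) A≤B)
                       (toCombo A) refl (toCombo B) refl
       ◅◅ (inj₁ (fromCombo-toCombo B) ◅ ε))
    where
    chain : ∀ A → Chain 0 (toList (toVec A)) (suc m)
    chain A = IsCombo⇒Chain (toVec A) (proj₂ (toCombo A))

𝒜[C[m,2]]≅C[m,2k] : ∀ m k → PosetIso (𝒜 k (CPoset m 2)) (CPoset m (2 * k))
𝒜[C[m,2]]≅C[m,2k] m k = record
  { to        = toCombo
  ; from      = fromCombo
  ; to-cong   = λ {A} {B} → toCombo-cong {A} {B}
  ; from-cong = λ {x} {y} → fromCombo-cong {x} {y}
  ; from-to   = fromCombo-toCombo
  ; to-from   = toCombo-fromCombo
  ; to-mono   = λ {A} {B} → toCombo-mono {A} {B}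
  ; to-refl   = λ {A} {B} → toCombo-reflects {A} {B}
  }
  where
  open AntichainsAsCombos m k
  open Monotonicity m k using (toCombo-mono)
  open Reflection m k using (toCombo-reflects)

proposition4p1 : (n k : ℕ) → k ≤ (n + 2) / 2 →
    PosetIso (𝒜 k (J[n×2] n)) (𝒜 k (CPoset (n + 2) 2))
    × PosetIso (𝒜 k (CPoset (n + 2) 2)) (CPoset (n + 2) (2 * k))
proposition4p1 n k _ =
    PosetIso-𝒜 (JPoset-isOrderSetoid _ _) (CPoset-isOrderSetoid (n + 2) 2) (J[n×2]≅C[n+2,2] n) k
  , 𝒜[C[m,2]]≅C[m,2k] (n + 2) k
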